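{- Let $k>4$ be an integer and $H=C_k^{\bowtie}$. Then (i) there is an edge $e$ of $H$ such that $N^*(e)$ induces exactly one edge, i.e. $e$ is contained in exactly one $4$-cycle of $H$; and (ii) if $X\subseteq V(H)$ spans exactly two edges, then $N^*(X)$ contains an edge of $H$.
   Context: $C_k$ is the cycle of length $k$. For a graph $G$, $G^{\bowtie}$ is obtained by replacing every vertex $v$ of $G$ by an edge $v_1v_2$ and, for every edge $uv\in E(G)$, adding the two edges $u_1v_2$ and $u_2v_1$. For $X\subseteq V(H)$, $N(X)$ is the union of the neighbourhoods of the vertices of $X$, and $N^*(X):=N(X)\setminus X$; for an edge $e$, $N^*(e)$ means $N^*$ of its vertex set. -}

module Defs where

open import Data.Nat using (ℕ; zero; suc)
open import Data.Fin using (Fin; toℕ)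
open import Data.Bool using (Bool; true; false)
open import Data.Product using (Σ; ∃; _×_; _,_)
open import Data.Sum using (_⊎_)
open import Relation.Nullary using (¬_)
open import Relation.Binary.PropositionalEquality using (_≡_; _≢_)

Next : (k : ℕ) → Fin k → Fin k → Set
Next k i j = (suc (toℕ i) ≡ toℕ j) ⊎ (suc (toℕ i) ≡ k × toℕ j ≡ 0)

CycleAdj : (k : ℕ) → Fin k → Fin k → Set
CycleAdj k i j = Next k i j ⊎ Next k j i

-- G^⋈ : vertex v becomes (v , false) = v₁ and (v , true) = v₂.
-- Edges: v₁v₂ for each v, and u₁v₂, u₂v₁ for each edge uv of G.
BowtieAdj : {V : Set} → (V → V → Set) → V × Bool → V × Bool → Set
BowtieAdj A (u , a) (v , b) = ((u ≡ v) ⊎ A u v) × (a ≢ b)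

HV : ℕ → Set
HV k = Fin k × Bool

HAdj : (k : ℕ) → HV k → HV k → Set
HAdj k = BowtieAdj (CycleAdj k)

module _ {V : Set} (Adj : V → V → Set) where

  NStar : (V → Set) → V → Set
  NStar S v = (∃ λ x → S x × Adj x v) × ¬ S v

  SamePair : V → V → V → V → Set
  SamePair x y a b = (x ≡ a × y ≡ b) ⊎ (x ≡ b × y ≡ a)

  ContainsEdge : (V → Set) → Set
  ContainsEdge S = Σ V λ x → Σ V λ y → S x × S y × Adj x y

  InducesExactlyOneEdge : (V → Set) → Set
  InducesExactlyOneEdge S =
    Σ V λ a → Σ V λ b → S a × S b × Adj a b ×
      (∀ x y → S x → S y → Adj x y → SamePair x y a b)

  SpansExactlyTwoEdges : (V → Set) → Set
  SpansExactlyTwoEdges S =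
    Σ V λ a → Σ V λ b → Σ V λ c → Σ V λ d →
      S a × S b × S c × S d × Adj a b × Adj c d × ¬ SamePair a b c d ×
      (∀ x y → S x → S y → Adj x y → SamePair x y a b ⊎ SamePair x y c d)

PairSet : {V : Set} → V → V → V → Set
PairSet u v w = (w ≡ u) ⊎ (w ≡ v)

Mem : {V : Set} → (V → Bool) → V → Set
Mem X v = X v ≡ true

module Submission where

open import Defs
open import Data.Nat using (ℕ; _<_)
open import Data.Bool using (Bool)
open import Data.Product using (Σ; _×_)
open import Data.Nat using (zero; suc; _+_; _≟_; s≤s)
open import Data.Nat.Properties using (<-irrefl; suc-injective; ≤∧≢⇒<; ≤-pred)
open import Data.Fin using (Fin; toℕ; fromℕ; fromℕ<; inject₁) renaming (zero to fzero; suc to fsuc)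
open import Data.Fin.Properties using (toℕ-injective; toℕ-fromℕ; toℕ-fromℕ<; toℕ-inject₁; toℕ<n)
open import Data.Bool using (true; false; not) renaming (_≟_ to _≟B_)
open import Data.Product using (_,_; proj₁; ∃)
open import Data.Sum using (_⊎_; inj₁; inj₂)
open import Data.Empty using (⊥; ⊥-elim)
open import Relation.Nullary using (¬_; yes; no)
open import Relation.Binary.PropositionalEquality using (_≡_; _≢_; refl; sym; trans; cong; ≢-sym)

-- (i) For e = (i , 0)(i+1 , 1), the set N*(e) consists of exactly the four
--     vertices (i-1 , 1), (i , 1), (i+1 , 0), (i+2 , 0), among which
--     (i+1 , 0)(i , 1) is the only edge; this needs k ≥ 5.
-- (ii) Holds already for k ≥ 3.  If X spans exactly two edges it contains no
--     three distinct edges.  A "vertical" edge (i , 0)(i , 1) ⊆ X forces the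
--     columns i+1 and i-1 to be vertical edges of N*(X) unless each meets X,
--     which would give two further edges of X.  A "diagonal" edge
--     (i , s)(i+1 , t) ⊆ X makes (i , t)(i+1 , s) an edge of N*(X) unless one
--     of its ends lies in X, which produces a vertical edge in X.

-- b is the successor of a on the cycle 0 → 1 → ⋯ → k-1 → 0; by definition
-- Next k i j unfolds to Step k (toℕ i) (toℕ j).
Step : ℕ → ℕ → ℕ → Set
Step k a b = (suc a ≡ b) ⊎ (suc a ≡ k × b ≡ 0)

-- A closed walk of ℓ successor steps winds around the cycle, so k ≤ ℓ.
no-1-cycle : ∀ {n a} → Step (2 + n) a a → ⊥
no-1-cycle (inj₁ ())
no-1-cycle (inj₂ (refl , ()))

no-2-cycle : ∀ {n a b} → Step (3 + n) a b → Step (3 + n) b a → ⊥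
no-2-cycle (inj₁ refl) (inj₁ ())
no-2-cycle (inj₁ refl) (inj₂ (refl , ()))
no-2-cycle (inj₂ (refl , refl)) (inj₁ ())
no-2-cycle (inj₂ (refl , refl)) (inj₂ (() , _))

no-3-cycle : ∀ {n a b c} → Step (4 + n) a b → Step (4 + n) b c → Step (4 + n) c a → ⊥
no-3-cycle (inj₁ refl) (inj₁ refl) (inj₁ ())
no-3-cycle (inj₁ refl) (inj₁ refl) (inj₂ (refl , ()))
no-3-cycle (inj₁ refl) (inj₂ (refl , refl)) (inj₁ ())
no-3-cycle (inj₁ refl) (inj₂ (refl , refl)) (inj₂ (() , _))
no-3-cycle (inj₂ (refl , refl)) (inj₁ refl) (inj₁ ())
no-3-cycle (inj₂ (refl , refl)) (inj₁ refl) (inj₂ (() , _))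
no-3-cycle (inj₂ (refl , refl)) (inj₂ (() , _)) _

no-4-cycle : ∀ {n a b c d} → Step (5 + n) a b → Step (5 + n) b c →
             Step (5 + n) c d → Step (5 + n) d a → ⊥
no-4-cycle (inj₁ refl) (inj₁ refl) (inj₁ refl) (inj₁ ())
no-4-cycle (inj₁ refl) (inj₁ refl) (inj₁ refl) (inj₂ (refl , ()))
no-4-cycle (inj₁ refl) (inj₁ refl) (inj₂ (refl , refl)) (inj₁ ())
no-4-cycle (inj₁ refl) (inj₁ refl) (inj₂ (refl , refl)) (inj₂ (() , _))
no-4-cycle (inj₁ refl) (inj₂ (refl , refl)) (inj₁ refl) (inj₁ ())
no-4-cycle (inj₁ refl) (inj₂ (refl , refl)) (inj₁ refl) (inj₂ (() , _))
no-4-cycle (inj₁ refl) (inj₂ (refl , refl)) (inj₂ (() , _)) _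
no-4-cycle (inj₂ (refl , refl)) (inj₁ refl) (inj₁ refl) (inj₁ ())
no-4-cycle (inj₂ (refl , refl)) (inj₁ refl) (inj₁ refl) (inj₂ (() , _))
no-4-cycle (inj₂ (refl , refl)) (inj₁ refl) (inj₂ (() , _)) _
no-4-cycle (inj₂ (refl , refl)) (inj₂ (() , _)) _ _

step-functional : ∀ {k a b b'} → b < k → b' < k → Step k a b → Step k a b' → b ≡ b'
step-functional _ _ (inj₁ refl) (inj₁ refl) = refl
step-functional b<k _ (inj₁ refl) (inj₂ (refl , _)) = ⊥-elim (<-irrefl refl b<k)
step-functional _ b'<k (inj₂ (refl , _)) (inj₁ refl) = ⊥-elim (<-irrefl refl b'<k)
step-functional _ _ (inj₂ (_ , refl)) (inj₂ (_ , refl)) = refl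

step-injective : ∀ {k a a' b} → Step k a b → Step k a' b → a ≡ a'
step-injective (inj₁ refl) (inj₁ e) = sym (suc-injective e)
step-injective (inj₁ refl) (inj₂ (_ , ()))
step-injective (inj₂ (_ , refl)) (inj₁ ())
step-injective (inj₂ (e , _)) (inj₂ (e' , _)) = suc-injective (trans e (sym e'))

successor : ∀ {k} (i : Fin k) → Σ (Fin k) λ j → Next k i j
successor {suc m} i with toℕ i ≟ m
... | yes i≡m = fzero , inj₂ (cong suc i≡m , refl)
... | no i≢m = fromℕ< i+1<k , inj₁ (sym (toℕ-fromℕ< i+1<k))
  where
  i+1<k : suc (toℕ i) < suc m
  i+1<k = s≤s (≤∧≢⇒< (≤-pred (toℕ<n i)) i≢m)

predecessor : ∀ {k} (i : Fin k) → Σ (Fin k) λ h → Next k h i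
predecessor {suc m} fzero = fromℕ m , inj₂ (cong suc (toℕ-fromℕ m) , refl)
predecessor {suc m} (fsuc i) = inject₁ i , inj₁ (cong suc (toℕ-inject₁ i))

Near : (k : ℕ) → Fin k → Fin k → Set
Near k i j = (i ≡ j) ⊎ CycleAdj k i j

module _ {k : ℕ} where

  next-functional : ∀ {i j j' : Fin k} → Next k i j → Next k i j' → j ≡ j'
  next-functional i→j i→j' = toℕ-injective (step-functional (toℕ<n _) (toℕ<n _) i→j i→j')

  next-injective : ∀ {i i' j : Fin k} → Next k i j → Next k i' j → i ≡ i'
  next-injective i→j i'→j = toℕ-injective (step-injective i→j i'→j)

  near-sym : ∀ {i j : Fin k} → Near k i j → Near k j i
  near-sym (inj₁ refl) = inj₁ refl
  near-sym (inj₂ (inj₁ i→j)) = inj₂ (inj₂ i→j)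
  near-sym (inj₂ (inj₂ j→i)) = inj₂ (inj₁ j→i)

  near-cases : ∀ {h i j x : Fin k} → Next k h i → Next k i j → Near k i x →
               x ≡ h ⊎ x ≡ i ⊎ x ≡ j
  near-cases _ _ (inj₁ refl) = inj₂ (inj₁ refl)
  near-cases _ i→j (inj₂ (inj₁ i→x)) = inj₂ (inj₂ (next-functional i→x i→j))
  near-cases h→i _ (inj₂ (inj₂ x→i)) = inj₁ (next-injective x→i h→i)

module _ {n : ℕ} where

  next-≢ : ∀ {i j : Fin (2 + n)} → Next (2 + n) i j → i ≢ j
  next-≢ i→j refl = no-1-cycle i→j

  two-steps-≢ : ∀ {h i j : Fin (3 + n)} → Next (3 + n) h i → Next (3 + n) i j → h ≢ j
  two-steps-≢ h→i i→j refl = no-2-cycle h→i i→j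

  not-near-2 : ∀ {a b c : Fin (4 + n)} → Next (4 + n) a b → Next (4 + n) b c → ¬ Near (4 + n) a c
  not-near-2 a→b b→c (inj₁ refl) = no-2-cycle a→b b→c
  not-near-2 a→b b→c (inj₂ (inj₁ a→c)) with next-functional a→b a→c
  ... | refl = no-1-cycle b→c
  not-near-2 a→b b→c (inj₂ (inj₂ c→a)) = no-3-cycle a→b b→c c→a

  not-near-3 : ∀ {a b c d : Fin (5 + n)} → Next (5 + n) a b → Next (5 + n) b c →
               Next (5 + n) c d → ¬ Near (5 + n) a d
  not-near-3 a→b b→c c→d (inj₁ refl) = no-3-cycle a→b b→c c→d
  not-near-3 a→b b→c c→d (inj₂ (inj₁ a→d)) with next-functional a→b a→d
  ... | refl = no-2-cycle b→c c→d
  not-near-3 a→b b→c c→d (inj₂ (inj₂ d→a)) = no-4-cycle a→b b→c c→d d→a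

off-column : ∀ {k} {i j : Fin k} {s t : Bool} → i ≢ j → (i , s) ≢ (j , t)
off-column i≢j e = i≢j (cong proj₁ e)

module _ {V : Set} (Adj : V → V → Set) where

  EdgeIn : (V → Set) → V → V → Set
  EdgeIn S x y = S x × S y × Adj x y

  NoThreeEdges : (V → Set) → Set
  NoThreeEdges S = ∀ {x₁ y₁ x₂ y₂ x₃ y₃} →
    EdgeIn S x₁ y₁ → EdgeIn S x₂ y₂ → EdgeIn S x₃ y₃ →
    ¬ SamePair Adj x₁ y₁ x₂ y₂ → ¬ SamePair Adj x₁ y₁ x₃ y₃ → ¬ SamePair Adj x₂ y₂ x₃ y₃ → ⊥

  same-pair-trans : ∀ {x y x' y' a b : V} →
    SamePair Adj x y a b → SamePair Adj x' y' a b → SamePair Adj x y x' y'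
  same-pair-trans (inj₁ (refl , refl)) (inj₁ (refl , refl)) = inj₁ (refl , refl)
  same-pair-trans (inj₁ (refl , refl)) (inj₂ (refl , refl)) = inj₂ (refl , refl)
  same-pair-trans (inj₂ (refl , refl)) (inj₁ (refl , refl)) = inj₂ (refl , refl)
  same-pair-trans (inj₂ (refl , refl)) (inj₂ (refl , refl)) = inj₁ (refl , refl)

  pair-with-other-end : ∀ {x y a b : V} → b ≢ x → b ≢ y → ¬ SamePair Adj x y a b
  pair-with-other-end _ b≢y (inj₁ (_ , refl)) = b≢y refl
  pair-with-other-end b≢x _ (inj₂ (refl , _)) = b≢x refl

  -- Pigeonhole: if S spans only the edges ab and cd, two of any three edges coincide.
  two-edges⇒no-three : ∀ {S} → SpansExactlyTwoEdges Adj S → NoThreeEdges S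
  two-edges⇒no-three (_ , _ , _ , _ , _ , _ , _ , _ , _ , _ , _ , only) (sx₁ , sy₁ , e₁) (sx₂ , sy₂ , e₂) (sx₃ , sy₃ , e₃) =
    pigeon (only _ _ sx₁ sy₁ e₁) (only _ _ sx₂ sy₂ e₂) (only _ _ sx₃ sy₃ e₃)
    where
    pigeon : ∀ {x₁ y₁ x₂ y₂ x₃ y₃ a b c d : V} →
      (SamePair Adj x₁ y₁ a b ⊎ SamePair Adj x₁ y₁ c d) →
      (SamePair Adj x₂ y₂ a b ⊎ SamePair Adj x₂ y₂ c d) →
      (SamePair Adj x₃ y₃ a b ⊎ SamePair Adj x₃ y₃ c d) →
      ¬ SamePair Adj x₁ y₁ x₂ y₂ → ¬ SamePair Adj x₁ y₁ x₃ y₃ → ¬ SamePair Adj x₂ y₂ x₃ y₃ → ⊥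
    pigeon (inj₁ p) (inj₁ q) _ n₁₂ _ _ = n₁₂ (same-pair-trans p q)
    pigeon (inj₂ p) (inj₂ q) _ n₁₂ _ _ = n₁₂ (same-pair-trans p q)
    pigeon (inj₁ p) _ (inj₁ q) _ n₁₃ _ = n₁₃ (same-pair-trans p q)
    pigeon (inj₂ p) _ (inj₂ q) _ n₁₃ _ = n₁₃ (same-pair-trans p q)
    pigeon _ (inj₁ p) (inj₁ q) _ _ n₂₃ = n₂₃ (same-pair-trans p q)
    pigeon _ (inj₂ p) (inj₂ q) _ _ n₂₃ = n₂₃ (same-pair-trans p q)

  edge-in-N*-or-meets : (X : V → Bool) {u v : V} → Adj u v →
    (∃ λ x → Mem X x × Adj x u) → (∃ λ x → Mem X x × Adj x v) →
    ContainsEdge Adj (NStar Adj (Mem X)) ⊎ (Mem X u ⊎ Mem X v)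
  edge-in-N*-or-meets X {u} {v} uv nbr-u nbr-v with X u ≟B true | X v ≟B true
  ... | yes Xu | _ = inj₂ (inj₁ Xu)
  ... | no _ | yes Xv = inj₂ (inj₂ Xv)
  ... | no u∉X | no v∉X = inj₁ (u , v , (nbr-u , u∉X) , (nbr-v , v∉X) , uv)

module TwoEdges {n : ℕ} (X : HV (3 + n) → Bool) (no-three : NoThreeEdges (HAdj (3 + n)) (Mem X)) where

  private
    k : ℕ
    k = 3 + n

  N*X : HV k → Set
  N*X = NStar (HAdj k) (Mem X)

  full-column : ∀ {i s t} → s ≢ t → Mem X (i , s) → Mem X (i , t) → ∀ b → Mem X (i , b)
  full-column {s = false} {false} s≢t _ _ = ⊥-elim (s≢t refl)
  full-column {s = false} {true} _ Xs Xt = λ { false → Xs ; true → Xt }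
  full-column {s = true} {false} _ Xs Xt = λ { false → Xt ; true → Xs }
  full-column {s = true} {true} s≢t _ _ = ⊥-elim (s≢t refl)

  column-meets : ∀ {i j} → Near k i j → (∀ b → Mem X (i , b)) →
    ContainsEdge (HAdj k) N*X ⊎ (Σ Bool λ t → EdgeIn (HAdj k) (Mem X) (i , not t) (j , t))
  column-meets near full
    with edge-in-N*-or-meets (HAdj k) X (inj₁ refl , λ ())
           (_ , full true , (near , λ ())) (_ , full false , (near , λ ()))
  ... | inj₁ found = inj₁ found
  ... | inj₂ (inj₁ Xj0) = inj₂ (false , full true , Xj0 , (near , λ ()))
  ... | inj₂ (inj₂ Xj1) = inj₂ (true , full false , Xj1 , (near , λ ()))

  -- X contains a whole column i: by column-meets each of the columns i+1 and
  -- i-1 gives an edge of N*(X) or a further edge of X, and the latter twice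
  -- would be three different edges of X.
  column-case : ∀ {i} → (∀ b → Mem X (i , b)) → ContainsEdge (HAdj k) N*X
  column-case {i} full with predecessor i | successor i
  ... | h , h→i | j , i→j with column-meets (inj₂ (inj₁ i→j)) full | column-meets (inj₂ (inj₂ h→i)) full
  ... | inj₁ found | _ = found
  ... | inj₂ _ | inj₁ found = found
  ... | inj₂ (_ , right) | inj₂ (_ , left) =
    ⊥-elim (no-three (full false , full true , (inj₁ refl , λ ())) right left
      (pair-with-other-end (HAdj k) (off-column j≢i) (off-column j≢i))
      (pair-with-other-end (HAdj k) (off-column h≢i) (off-column h≢i))
      (pair-with-other-end (HAdj k) (off-column h≢i) (off-column (two-steps-≢ h→i i→j))))
    where
    j≢i : j ≢ i
    j≢i = ≢-sym (next-≢ i→j)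
    h≢i : h ≢ i
    h≢i = next-≢ h→i

  vertical-case : ∀ {i s t} → s ≢ t → Mem X (i , s) → Mem X (i , t) → ContainsEdge (HAdj k) N*X
  vertical-case s≢t Xs Xt = column-case (full-column s≢t Xs Xt)

  diagonal-case : ∀ {i j s t} → Next k i j → s ≢ t → Mem X (i , s) → Mem X (j , t) →
                  ContainsEdge (HAdj k) N*X
  diagonal-case {i} {j} {s} {t} i→j s≢t Xs Xt
    with edge-in-N*-or-meets (HAdj k) X {i , t} {j , s} (inj₂ (inj₁ i→j) , ≢-sym s≢t)
           (_ , Xs , (inj₁ refl , s≢t)) (_ , Xt , (inj₁ refl , ≢-sym s≢t))
  ... | inj₁ found = found
  ... | inj₂ (inj₁ X-it) = vertical-case s≢t Xs X-it
  ... | inj₂ (inj₂ X-js) = vertical-case (≢-sym s≢t) Xt X-js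

  edge-case : ∀ {x y} → HAdj k x y → Mem X x → Mem X y → ContainsEdge (HAdj k) N*X
  edge-case (inj₁ refl , s≢t) = vertical-case s≢t
  edge-case (inj₂ (inj₁ i→j) , s≢t) = diagonal-case i→j s≢t
  edge-case (inj₂ (inj₂ j→i) , s≢t) Xx Xy = diagonal-case j→i (≢-sym s≢t) Xy Xx

two-edges⇒N*-edge : ∀ n (X : HV (3 + n) → Bool) → SpansExactlyTwoEdges (HAdj (3 + n)) (Mem X) →
  ContainsEdge (HAdj (3 + n)) (NStar (HAdj (3 + n)) (Mem X))
two-edges⇒N*-edge n X two@(_ , _ , _ , _ , Xa , Xb , _ , _ , ab , _) =
  TwoEdges.edge-case X (two-edges⇒no-three (HAdj (3 + n)) two) ab Xa Xb

-- Part (i), for k ≥ 5: around the path h → i → j → j' of C_k, the edge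
-- e = (i , 0)(j , 1) has N*(e) = {(h , 1), (i , 1), (j , 0), (j' , 0)},
-- which spans only the edge (j , 0)(i , 1).
module OneFourCycle {n : ℕ} {h i j j' : Fin (5 + n)}
                    (h→i : Next (5 + n) h i) (i→j : Next (5 + n) i j) (j→j' : Next (5 + n) j j') where

  private
    k : ℕ
    k = 5 + n

  e₀ e₁ : HV k
  e₀ = i , false
  e₁ = j , true

  N*e : HV k → Set
  N*e = NStar (HAdj k) (PairSet e₀ e₁)

  data Rim : HV k → Set where
    rim-h : Rim (h , true)
    rim-i : Rim (i , true)
    rim-j : Rim (j , false)
    rim-j' : Rim (j' , false)

  rim : ∀ {x} → N*e x → Rim x
  rim {_ , false} ((_ , inj₁ refl , (_ , f≢f)) , _) = ⊥-elim (f≢f refl)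
  rim {c , true} ((_ , inj₁ refl , (near , _)) , x∉e) with near-cases h→i i→j near
  ... | inj₁ refl = rim-h
  ... | inj₂ (inj₁ refl) = rim-i
  ... | inj₂ (inj₂ refl) = ⊥-elim (x∉e (inj₂ refl))
  rim {_ , true} ((_ , inj₂ refl , (_ , t≢t)) , _) = ⊥-elim (t≢t refl)
  rim {c , false} ((_ , inj₂ refl , (near , _)) , x∉e) with near-cases i→j j→j' near
  ... | inj₁ refl = ⊥-elim (x∉e (inj₁ refl))
  ... | inj₂ (inj₁ refl) = rim-j
  ... | inj₂ (inj₂ refl) = rim-j'

  -- Rim vertices on the same side are never adjacent, and the only adjacent
  -- columns among h, i | j, j' are i and j.
  rim-edge : ∀ {x y} → Rim x → Rim y → HAdj k x y → SamePair (HAdj k) x y (j , false) (i , true)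
  rim-edge rim-i rim-j _ = inj₂ (refl , refl)
  rim-edge rim-j rim-i _ = inj₁ (refl , refl)
  rim-edge rim-h rim-j (near , _) = ⊥-elim (not-near-2 h→i i→j near)
  rim-edge rim-j rim-h (near , _) = ⊥-elim (not-near-2 h→i i→j (near-sym near))
  rim-edge rim-i rim-j' (near , _) = ⊥-elim (not-near-2 i→j j→j' near)
  rim-edge rim-j' rim-i (near , _) = ⊥-elim (not-near-2 i→j j→j' (near-sym near))
  rim-edge rim-h rim-j' (near , _) = ⊥-elim (not-near-3 h→i i→j j→j' near)
  rim-edge rim-j' rim-h (near , _) = ⊥-elim (not-near-3 h→i i→j j→j' (near-sym near))
  rim-edge rim-h rim-h (_ , t≢t) = ⊥-elim (t≢t refl)
  rim-edge rim-h rim-i (_ , t≢t) = ⊥-elim (t≢t refl)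
  rim-edge rim-i rim-h (_ , t≢t) = ⊥-elim (t≢t refl)
  rim-edge rim-i rim-i (_ , t≢t) = ⊥-elim (t≢t refl)
  rim-edge rim-j rim-j (_ , t≢t) = ⊥-elim (t≢t refl)
  rim-edge rim-j rim-j' (_ , t≢t) = ⊥-elim (t≢t refl)
  rim-edge rim-j' rim-j (_ , t≢t) = ⊥-elim (t≢t refl)
  rim-edge rim-j' rim-j' (_ , t≢t) = ⊥-elim (t≢t refl)

  e-is-edge : HAdj k e₀ e₁
  e-is-edge = inj₂ (inj₁ i→j) , λ ()

  N*e-induces-one-edge : InducesExactlyOneEdge (HAdj k) N*e
  N*e-induces-one-edge =
    (j , false) , (i , true) ,
    ((e₁ , inj₂ refl , (inj₁ refl , λ ())) , λ { (inj₁ e) → off-column j≢i e ; (inj₂ ()) }) ,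
    ((e₀ , inj₁ refl , (inj₁ refl , λ ())) , λ { (inj₁ ()) ; (inj₂ e) → off-column i≢j e }) ,
    (inj₂ (inj₂ i→j) , λ ()) ,
    λ x y x∈N* y∈N* xy → rim-edge (rim x∈N*) (rim y∈N*) xy
    where
    i≢j : i ≢ j
    i≢j = next-≢ i→j
    j≢i : j ≢ i
    j≢i = ≢-sym i≢j

edge-with-one-N*-edge : ∀ n (i : Fin (5 + n)) → Σ (HV (5 + n)) λ u → Σ (HV (5 + n)) λ v →
  HAdj (5 + n) u v × InducesExactlyOneEdge (HAdj (5 + n)) (NStar (HAdj (5 + n)) (PairSet u v))
edge-with-one-N*-edge n i with predecessor i | successor i
... | _ , h→i | j , i→j with successor j
... | _ , j→j' = (i , false) , (j , true) , e-is-edge , N*e-induces-one-edge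
  where open OneFourCycle h→i i→j j→j'

lemma3p3 : (k : ℕ) → 4 < k →
    (Σ (HV k) λ u → Σ (HV k) λ v → HAdj k u v ×
       InducesExactlyOneEdge (HAdj k) (NStar (HAdj k) (PairSet u v)))
    × ((X : HV k → Bool) → SpansExactlyTwoEdges (HAdj k) (Mem X) →
         ContainsEdge (HAdj k) (NStar (HAdj k) (Mem X)))
lemma3p3 (suc (suc (suc (suc (suc n))))) _ = edge-with-one-N*-edge n fzero , two-edges⇒N*-edge (2 + n)
lemma3p3 (suc (suc (suc (suc zero)))) (s≤s (s≤s (s≤s (s≤s ()))))
lemma3p3 (suc (suc (suc zero))) (s≤s (s≤s (s≤s ())))
lemma3p3 (suc (suc zero)) (s≤s (s≤s ()))
lemma3p3 (suc zero) (s≤s ())
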